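{- Let $a,b$ be relatively prime integers with $1<a<b$, let $S=\langle a,b\rangle$, and let $(u,v)$ be the definitely least solution of $ax+by=1$. Then \[\min I(S)=F(S)-(|u|-1)a-(|v|-1)b.\]
   Context: $\langle a,b\rangle=\{\lambda_1a+\lambda_2b:\lambda_1,\lambda_2\in\mathbb{N}\}$. $F(S)$ is the Frobenius number of $S$, the largest integer not in $S$. $I(S)$ is the set of isolated gaps of $S$ (elements $x\in\mathbb{N}\setminus S$ with $x-1,x+1\in S$). The definitely least solution $(u,v)$ of $ax+by=1$ is the integer solution for which both $|u|$ and $|v|$ are least possible; it is unique, and is the unique solution with $|u|\le b/2$, $|v|\le a/2$. -}

module Defs where

open import Data.Nat using (ℕ; suc; _+_; _*_; _<_; _≤_)
open import Data.Integer as ℤ using (ℤ; +_; ∣_∣)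
open import Data.Product using (∃₂; Σ; _×_)
open import Relation.Nullary using (¬_)
open import Relation.Binary.PropositionalEquality using (_≡_)

InSG : ℕ → ℕ → ℕ → Set
InSG a b n = ∃₂ λ l₁ l₂ → l₁ * a + l₂ * b ≡ n

IsFrobenius : ℕ → ℕ → ℕ → Set
IsFrobenius a b F = ¬ InSG a b F × (∀ n → ¬ InSG a b n → n ≤ F)

IsolatedGap : ℕ → ℕ → ℕ → Set
IsolatedGap a b x = Σ ℕ λ y → (x ≡ suc y) × InSG a b y × ¬ InSG a b x × InSG a b (suc x)

IsMinIsolatedGap : ℕ → ℕ → ℕ → Set
IsMinIsolatedGap a b m = IsolatedGap a b m × (∀ x → IsolatedGap a b x → m ≤ x)

Solves : ℕ → ℕ → ℤ → ℤ → Set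
Solves a b u v = (+ a) ℤ.* u ℤ.+ (+ b) ℤ.* v ≡ + 1

DefinitelyLeast : ℕ → ℕ → ℤ → ℤ → Set
DefinitelyLeast a b u v =
  Solves a b u v × (∀ x y → Solves a b x y → ∣ u ∣ ≤ ∣ x ∣ × ∣ v ∣ ≤ ∣ y ∣)

{-# OPTIONS --safe #-}
-- Write the definitely least solution as 1 + V b = U a (or the same with a and b
-- swapped); minimality of |u| = U against the solution (u - b, v + a) gives 2U ≤ b.
-- Put b = 2U + c and m = c a + 1. Then m - 1 = c a ∈ S, m + 1 = a b - 2V b is a
-- multiple of b, and m ∉ S because m + U a + V b = a b has no representation with
-- both coefficients positive. If x = p a + q b + 1 is an isolated gap with
-- x + 1 = r a + s b, then p ≥ c gives x ≥ m, r ≥ U gives x = (r - U) a + (s + V) b ∈ S,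
-- and otherwise 2 = 2U a - 2V b makes b divide 2U + p - r, which lies strictly
-- between 0 and b. Sylvester's F = a b - a - b turns m into F - (U - 1) a - (V - 1) b.
module Submission where

open import Defs
open import Data.Nat using (ℕ; _<_)
open import Data.Nat.Coprimality using (Coprime)
open import Data.Integer as ℤ using (ℤ; +_; ∣_∣)
open import Data.Product using (Σ; _×_)
open import Relation.Binary.PropositionalEquality using (_≡_)

open import Function using (_∘_)
open import Data.Nat
open import Data.Nat.Properties
open import Data.Nat.Divisibility using (_∣_; divides; ∣m+n∣m⇒∣n; n∣m*n; ∣⇒≤)
open import Data.Nat.DivMod using (_/_; _%_; m≡m%n+[m/n]*n; m%n<n)
open import Data.Nat.GCD using (module Bézout)
import Data.Nat.Coprimality as Coprime
open import Data.Nat.Tactic.RingSolver using (solve)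
open import Data.Product using (_,_; ∃; proj₁; proj₂)
open import Data.Sum as Sum using (_⊎_; inj₁; inj₂)
open import Relation.Nullary using (¬_; yes; no; contradiction)
open import Relation.Binary.PropositionalEquality
open import Data.List using (_∷_; [])
open import Data.Integer using (-[1+_])
import Data.Integer.Properties as ℤ
import Data.Integer.Tactic.RingSolver as ℤ-Solver
open import Algebra.Properties.CommutativeSemigroup +-commutativeSemigroup using (xy∙z≈xz∙y)

InSG-comm : ∀ {a b n} → InSG a b n → InSG b a n
InSG-comm (l₁ , l₂ , eq) = l₂ , l₁ , trans (+-comm (l₂ * _) (l₁ * _)) eq

IsolatedGap-comm : ∀ {a b x} → IsolatedGap a b x → IsolatedGap b a x
IsolatedGap-comm (y , x≡1+y , y∈S , x∉S , 1+x∈S) =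
  y , x≡1+y , InSG-comm y∈S , x∉S ∘ InSG-comm , InSG-comm 1+x∈S

IsMinIsolatedGap-comm : ∀ {a b m} → IsMinIsolatedGap a b m → IsMinIsolatedGap b a m
IsMinIsolatedGap-comm (gap , minimal) = IsolatedGap-comm gap , λ x → minimal x ∘ IsolatedGap-comm

IsFrobenius-comm : ∀ {a b F} → IsFrobenius a b F → IsFrobenius b a F
IsFrobenius-comm (F∉S , F-max) = F∉S ∘ InSG-comm , λ n n∉S → F-max n (n∉S ∘ InSG-comm)

Solves-comm : ∀ {a b u v} → Solves a b u v → Solves b a v u
Solves-comm {a} {b} {u} {v} sol = trans (ℤ.+-comm (+ b ℤ.* v) (+ a ℤ.* u)) sol

m+n≢0 : ∀ m n .{{_ : NonZero n}} → NonZero (m + n)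
m+n≢0 m (suc _) = ≢-nonZero (m+1+n≢0 m)

t*a+q*b≡s*b⇒b∣t : ∀ {a b t q s} → Coprime a b → t * a + q * b ≡ s * b → b ∣ t
t*a+q*b≡s*b⇒b∣t {a} {b} {t} {q} {s} a⊥b eq =
  Coprime.coprime-divisor (Coprime.sym a⊥b) (subst (b ∣_) (*-comm t a) b∣t*a)
  where
  b∣t*a : b ∣ t * a
  b∣t*a = ∣m+n∣m⇒∣n (subst (b ∣_) (trans (sym eq) (+-comm (t * a) (q * b))) (n∣m*n s)) (n∣m*n q)

p*a+q*b≢a*b : ∀ {a b p q} → Coprime a b → .{{NonZero a}} → .{{NonZero p}} → .{{NonZero q}} →
              p * a + q * b ≢ a * b
p*a+q*b≢a*b {a} {b} {p} {q} a⊥b eq = <-irrefl (sym eq) (begin-strict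
  a * b           ≤⟨ *-monoˡ-≤ b a≤q ⟩
  q * b           <⟨ m<n+m (q * b) (>-nonZero⁻¹ (p * a) {{m*n≢0 p a}}) ⟩
  p * a + q * b   ∎)
  where
  open ≤-Reasoning
  a≤q : a ≤ q
  a≤q = ∣⇒≤ (t*a+q*b≡s*b⇒b∣t {q = p} {s = b} (Coprime.sym a⊥b)
          (trans (+-comm (q * b) (p * a)) (trans eq (*-comm a b))))

-- With n x = α + k b and α < b: n = α a + (k a - n y) b, where k a < n y would force α a ≥ n + b.
bézout∧a*b<n+a+b⇒InSG : ∀ {a b x y} → 1 + y * b ≡ x * a → .{{NonZero b}} →
                        ∀ n → a * b < n + a + b → InSG a b n
bézout∧a*b<n+a+b⇒InSG {a} {b} {x} {y} bézout n ab<n+a+b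
  with n * x % b | n * x / b | m%n<n (n * x) b | m≡m%n+[m/n]*n (n * x) b
... | α | k | α<b | nx≡α+kb =
  represent (Sum.map (λ ny≤ka → m≤n⇒∃[o]m+o≡n ny≤ka) (λ ka<ny → m≤n⇒∃[o]m+o≡n ka<ny)
                     (≤-<-connex (n * y) (k * a)))
  where
  open ≤-Reasoning

  α*a+k*b*a≡n+n*y*b : α * a + k * b * a ≡ n + n * y * b
  α*a+k*b*a≡n+n*y*b = begin-equality
    α * a + k * b * a   ≡⟨ solve (α ∷ k ∷ a ∷ b ∷ []) ⟩
    (α + k * b) * a     ≡⟨ cong (_* a) nx≡α+kb ⟨
    n * x * a           ≡⟨ *-assoc n x a ⟩
    n * (x * a)         ≡⟨ cong (n *_) bézout ⟨
    n * (1 + y * b)     ≡⟨ solve (n ∷ y ∷ b ∷ []) ⟩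
    n + n * y * b       ∎

  represent : (∃ λ β → n * y + β ≡ k * a) ⊎ (∃ λ t → suc (k * a) + t ≡ n * y) → InSG a b n
  represent (inj₁ (β , ny+β≡ka)) = α , β , +-cancelˡ-≡ (n * y * b) _ _ (begin-equality
    n * y * b + (α * a + β * b)   ≡⟨ solve (n ∷ y ∷ b ∷ α ∷ a ∷ β ∷ []) ⟩
    α * a + (n * y + β) * b       ≡⟨ cong (λ l → α * a + l * b) ny+β≡ka ⟩
    α * a + k * a * b             ≡⟨ solve (α ∷ a ∷ k ∷ b ∷ []) ⟩
    α * a + k * b * a             ≡⟨ α*a+k*b*a≡n+n*y*b ⟩
    n + n * y * b                 ≡⟨ +-comm n (n * y * b) ⟩
    n * y * b + n                 ∎)
  represent (inj₂ (t , ka+1+t≡ny)) = contradiction ab<n+a+b (≤⇒≯ (begin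
    n + a + b           ≡⟨ xy∙z≈xz∙y n a b ⟩
    n + b + a           ≤⟨ +-monoˡ-≤ a (m≤m+n (n + b) (t * b)) ⟩
    n + b + t * b + a   ≡⟨ cong (_+ a) α*a≡n+b+t*b ⟨
    α * a + a           ≡⟨ +-comm (α * a) a ⟩
    suc α * a           ≤⟨ *-monoˡ-≤ a α<b ⟩
    b * a               ≡⟨ *-comm b a ⟩
    a * b               ∎))
    where
    α*a≡n+b+t*b : α * a ≡ n + b + t * b
    α*a≡n+b+t*b = +-cancelˡ-≡ (k * a * b) _ _ (begin-equality
      k * a * b + α * a           ≡⟨ solve (k ∷ a ∷ b ∷ α ∷ []) ⟩
      α * a + k * b * a           ≡⟨ α*a+k*b*a≡n+n*y*b ⟩
      n + n * y * b               ≡⟨ cong (λ l → n + l * b) ka+1+t≡ny ⟨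
      n + (suc (k * a) + t) * b   ≡⟨ solve (n ∷ k ∷ a ∷ t ∷ b ∷ []) ⟩
      k * a * b + (n + b + t * b) ∎)

a*b<n+a+b⇒InSG : ∀ {a b} → Coprime a b → .{{NonZero a}} → .{{NonZero b}} →
                 ∀ n → a * b < n + a + b → InSG a b n
a*b<n+a+b⇒InSG {a} {b} a⊥b n ab<n+a+b with Coprime.coprime-Bézout a⊥b
... | Bézout.+- x y bézout = bézout∧a*b<n+a+b⇒InSG {x = x} {y} bézout n ab<n+a+b
... | Bézout.-+ x y bézout =
  InSG-comm (bézout∧a*b<n+a+b⇒InSG {x = y} {x} bézout n
              (subst₂ _<_ (*-comm a b) (xy∙z≈xz∙y n a b) ab<n+a+b))

a+b≤a*b : ∀ {a b} → 2 ≤ a → 2 ≤ b → a + b ≤ a * b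
a+b≤a*b {a@(suc (suc a′))} {b@(suc (suc b′))} (s≤s (s≤s _)) (s≤s (s≤s _)) = begin
  a + b                         ≤⟨ m≤m+n (a + b) (a′ + b′ + a′ * b′) ⟩
  a + b + (a′ + b′ + a′ * b′)   ≡⟨ solve (a′ ∷ b′ ∷ []) ⟩
  a * b                         ∎
  where open ≤-Reasoning

IsFrobenius⇒F+a+b≡a*b : ∀ {a b F} → Coprime a b → 2 ≤ a → 2 ≤ b → IsFrobenius a b F →
                        F + a + b ≡ a * b
IsFrobenius⇒F+a+b≡a*b {a} {b} {F} a⊥b 2≤a 2≤b (F∉S , F-max)
  with m≤n⇒∃[o]m+o≡n (a+b≤a*b 2≤a 2≤b)
... | g , a+b+g≡ab = ≤-antisym
  (≮⇒≥ (F∉S ∘ a*b<n+a+b⇒InSG a⊥b F))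
  (begin
    a * b       ≡⟨ a+b+g≡ab ⟨
    a + b + g   ≤⟨ +-monoʳ-≤ (a + b) (F-max g g∉S) ⟩
    a + b + F   ≡⟨ solve (a ∷ b ∷ F ∷ []) ⟩
    F + a + b   ∎)
  where
  open ≤-Reasoning
  instance
    a≢0 : NonZero a
    a≢0 = >-nonZero (<-trans z<s 2≤a)
    b≢0 : NonZero b
    b≢0 = >-nonZero (<-trans z<s 2≤b)
  g∉S : ¬ InSG a b g
  g∉S (l₁ , l₂ , l₁a+l₂b≡g) = p*a+q*b≢a*b {p = suc l₁} {suc l₂} a⊥b (begin-equality
    suc l₁ * a + suc l₂ * b     ≡⟨ solve (l₁ ∷ a ∷ l₂ ∷ b ∷ []) ⟩
    a + b + (l₁ * a + l₂ * b)   ≡⟨ cong (_+_ (a + b)) l₁a+l₂b≡g ⟩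
    a + b + g                   ≡⟨ a+b+g≡ab ⟩
    a * b                       ∎)

module MinimalIsolatedGap {a b c U V : ℕ} (a⊥b : Coprime a b) (2≤a : 2 ≤ a)
                          (bézout : 1 + V * b ≡ U * a) (2U+c≡b : 2 * U + c ≡ b) where

  instance
    a≢0 : NonZero a
    a≢0 = >-nonZero (<-trans z<s 2≤a)

    U≢0 : NonZero U
    U≢0 = ≢-nonZero λ { refl → 1+n≢0 bézout }

    V≢0 : NonZero V
    V≢0 = ≢-nonZero λ { refl → <⇒≢ 2≤a (sym (m*n≡1⇒n≡1 U a (sym bézout))) }

  m : ℕ
  m = suc (c * a)

  c*a+2*[U*a]≡a*b : c * a + 2 * (U * a) ≡ a * b
  c*a+2*[U*a]≡a*b = begin
    c * a + 2 * (U * a)   ≡⟨ solve (c ∷ a ∷ U ∷ []) ⟩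
    (2 * U + c) * a       ≡⟨ cong (_* a) 2U+c≡b ⟩
    b * a                 ≡⟨ *-comm b a ⟩
    a * b                 ∎
    where open ≡-Reasoning

  m+U*a+V*b≡a*b : m + U * a + V * b ≡ a * b
  m+U*a+V*b≡a*b = begin
    1 + c * a + U * a + V * b   ≡⟨ solve (c ∷ a ∷ U ∷ V ∷ b ∷ []) ⟩
    c * a + U * a + (1 + V * b) ≡⟨ cong (_+_ (c * a + U * a)) bézout ⟩
    c * a + U * a + U * a       ≡⟨ solve (c ∷ a ∷ U ∷ []) ⟩
    c * a + 2 * (U * a)         ≡⟨ c*a+2*[U*a]≡a*b ⟩
    a * b                       ∎
    where open ≡-Reasoning

  2*V*b+suc[m]≡a*b : 2 * V * b + suc m ≡ a * b
  2*V*b+suc[m]≡a*b = begin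
    2 * V * b + (2 + c * a)   ≡⟨ solve (c ∷ a ∷ V ∷ b ∷ []) ⟩
    c * a + 2 * (1 + V * b)   ≡⟨ cong (λ n → c * a + 2 * n) bézout ⟩
    c * a + 2 * (U * a)       ≡⟨ c*a+2*[U*a]≡a*b ⟩
    a * b                     ∎
    where open ≡-Reasoning

  m∉S : ¬ InSG a b m
  m∉S (l , μ , la+μb≡m) =
    p*a+q*b≢a*b {p = l + U} {μ + V} a⊥b {{a≢0}} {{m+n≢0 l U}} {{m+n≢0 μ V}} (begin
      (l + U) * a + (μ + V) * b       ≡⟨ solve (l ∷ U ∷ a ∷ μ ∷ V ∷ b ∷ []) ⟩
      l * a + μ * b + U * a + V * b   ≡⟨ cong (λ n → n + U * a + V * b) la+μb≡m ⟩
      m + U * a + V * b               ≡⟨ m+U*a+V*b≡a*b ⟩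
      a * b                           ∎)
    where open ≡-Reasoning

  c*a∈S : InSG a b (c * a)
  c*a∈S = c , 0 , +-identityʳ (c * a)

  suc[m]∈S : InSG a b (suc m)
  suc[m]∈S with ∣m+n∣m⇒∣n (subst (b ∣_) (sym 2*V*b+suc[m]≡a*b) (n∣m*n a)) (n∣m*n (2 * V))
  ... | divides e suc[m]≡e*b = 0 , e , sym suc[m]≡e*b

  U≤r⇒pred∈S : ∀ {r s x} → U ≤ r → r * a + s * b ≡ suc x → InSG a b x
  U≤r⇒pred∈S {r} {s} {x} U≤r ra+sb≡1+x with m≤n⇒∃[o]m+o≡n U≤r
  ... | o , U+o≡r = o , s + V , suc-injective (begin
    1 + (o * a + (s + V) * b)     ≡⟨ solve (o ∷ a ∷ s ∷ V ∷ b ∷ []) ⟩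
    (1 + V * b) + o * a + s * b   ≡⟨ cong (λ n → n + o * a + s * b) bézout ⟩
    U * a + o * a + s * b         ≡⟨ solve (U ∷ a ∷ o ∷ s ∷ b ∷ []) ⟩
    (U + o) * a + s * b           ≡⟨ cong (λ n → n * a + s * b) U+o≡r ⟩
    r * a + s * b                 ≡⟨ ra+sb≡1+x ⟩
    suc x                         ∎)
    where open ≡-Reasoning

  2+[p*a+q*b]≢r*a+s*b : ∀ {p q r s} → p < c → r < U → 2 + (p * a + q * b) ≢ r * a + s * b
  2+[p*a+q*b]≢r*a+s*b {p} {q} {r} {s} p<c r<U eq
    with m≤n⇒∃[o]m+o≡n (<-≤-trans r<U (≤-trans (m≤n*m U 2) (m≤m+n (2 * U) p)))
  ... | t , 1+r+t≡2U+p = <⇒≱ suc[t]<b b≤suc[t]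
    where
    open ≤-Reasoning
    suc[t]<b : suc t < b
    suc[t]<b = begin-strict
      suc t       ≤⟨ m≤n+m (suc t) r ⟩
      r + suc t   ≡⟨ trans (+-suc r t) 1+r+t≡2U+p ⟩
      2 * U + p   <⟨ +-monoʳ-< (2 * U) p<c ⟩
      2 * U + c   ≡⟨ 2U+c≡b ⟩
      b           ∎
    suc[t]*a+q*b≡[s+2V]*b : suc t * a + q * b ≡ (s + 2 * V) * b
    suc[t]*a+q*b≡[s+2V]*b = +-cancelˡ-≡ (r * a) _ _ (begin-equality
      r * a + (suc t * a + q * b)       ≡⟨ solve (r ∷ t ∷ a ∷ q ∷ b ∷ []) ⟩
      (suc r + t) * a + q * b           ≡⟨ cong (λ n → n * a + q * b) 1+r+t≡2U+p ⟩
      (2 * U + p) * a + q * b           ≡⟨ solve (U ∷ p ∷ a ∷ q ∷ b ∷ []) ⟩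
      p * a + q * b + 2 * (U * a)       ≡⟨ cong (λ n → p * a + q * b + 2 * n) bézout ⟨
      p * a + q * b + 2 * (1 + V * b)   ≡⟨ solve (p ∷ a ∷ q ∷ b ∷ V ∷ []) ⟩
      2 + (p * a + q * b) + 2 * V * b   ≡⟨ cong (_+ 2 * V * b) eq ⟩
      r * a + s * b + 2 * V * b         ≡⟨ solve (r ∷ a ∷ s ∷ b ∷ V ∷ []) ⟩
      r * a + (s + 2 * V) * b           ∎)
    b≤suc[t] : b ≤ suc t
    b≤suc[t] = ∣⇒≤ (t*a+q*b≡s*b⇒b∣t {q = q} {s = s + 2 * V} a⊥b suc[t]*a+q*b≡[s+2V]*b)

  m≤isolatedGap : ∀ x → IsolatedGap a b x → m ≤ x
  m≤isolatedGap .(suc y) (y , refl , (p , q , pa+qb≡y) , x∉S , (r , s , ra+sb≡2+y))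
    with c ≤? p | U ≤? r
  ... | yes c≤p | _ = s≤s (begin
    c * a           ≤⟨ *-monoˡ-≤ a c≤p ⟩
    p * a           ≤⟨ m≤m+n (p * a) (q * b) ⟩
    p * a + q * b   ≡⟨ pa+qb≡y ⟩
    y               ∎)
    where open ≤-Reasoning
  ... | no _ | yes U≤r = contradiction (U≤r⇒pred∈S {s = s} U≤r ra+sb≡2+y) x∉S
  ... | no c≰p | no U≰r =
    contradiction (trans (cong (_+_ 2) pa+qb≡y) (sym ra+sb≡2+y))
                  (2+[p*a+q*b]≢r*a+s*b {q = q} {s = s} (≰⇒> c≰p) (≰⇒> U≰r))

  isMinIsolatedGap : IsMinIsolatedGap a b m
  isMinIsolatedGap = (c * a , refl , c*a∈S , m∉S , suc[m]∈S) , m≤isolatedGap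

bézout⇒minIsolatedGap : ∀ {a b U V F} → Coprime a b → 2 ≤ a → 2 ≤ b →
                        1 + V * b ≡ U * a → 2 * U ≤ b → IsFrobenius a b F →
                        Σ ℕ λ m → IsMinIsolatedGap a b m × m + U * a + V * b ≡ F + a + b
bézout⇒minIsolatedGap {U = U} {V} a⊥b 2≤a 2≤b bézout 2U≤b frob
  with m≤n⇒∃[o]m+o≡n 2U≤b
... | c , 2U+c≡b =
  m , isMinIsolatedGap , trans m+U*a+V*b≡a*b (sym (IsFrobenius⇒F+a+b≡a*b a⊥b 2≤a 2≤b frob))
  where open MinimalIsolatedGap {U = U} {V} a⊥b 2≤a bézout 2U+c≡b

m≤∣m⊖n∣⇒2*m≤n : ∀ {m n} → .{{NonZero n}} → m ≤ ∣ m ℤ.⊖ n ∣ → 2 * m ≤ n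
m≤∣m⊖n∣⇒2*m≤n {m} {n} m≤∣m⊖n∣ with m ≤? n
... | yes m≤n = begin
  2 * m         ≡⟨ solve (m ∷ []) ⟩
  m + m         ≤⟨ +-monoʳ-≤ m (subst (m ≤_) (ℤ.∣⊖∣-≤ m≤n) m≤∣m⊖n∣) ⟩
  m + (n ∸ m)   ≡⟨ m+[n∸m]≡n m≤n ⟩
  n             ∎
  where open ≤-Reasoning
... | no m≰n = contradiction m≤∣m⊖n∣ (<⇒≱ (begin-strict
  ∣ m ℤ.⊖ n ∣   ≡⟨ ℤ.∣m⊖n∣≡∣n⊖m∣ m n ⟩
  ∣ n ℤ.⊖ m ∣   ≡⟨ ℤ.∣⊖∣-≰ m≰n ⟩
  m ∸ n         <⟨ ∸-monoʳ-< (>-nonZero⁻¹ n) (≰⇒≥ m≰n) ⟩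
  m             ∎))
  where open ≤-Reasoning

∣i∣≤∣i∓n∣⇒2*∣i∣≤n : ∀ i {n} → .{{NonZero n}} →
                    ∣ i ∣ ≤ ∣ i ℤ.- + n ∣ → ∣ i ∣ ≤ ∣ i ℤ.+ + n ∣ → 2 * ∣ i ∣ ≤ n
∣i∣≤∣i∓n∣⇒2*∣i∣≤n (+ k) {n} ≤∣i-n∣ _ =
  m≤∣m⊖n∣⇒2*m≤n (subst (k ≤_) (cong ∣_∣ (ℤ.m-n≡m⊖n k n)) ≤∣i-n∣)
∣i∣≤∣i∓n∣⇒2*∣i∣≤n -[1+ k ] {n} _ ≤∣i+n∣ =
  m≤∣m⊖n∣⇒2*m≤n (subst (suc k ≤_) (ℤ.∣m⊖n∣≡∣n⊖m∣ n (suc k)) ≤∣i+n∣)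

DefinitelyLeast⇒2*∣u∣≤b×2*∣v∣≤a : ∀ {a b u v} → .{{NonZero a}} → .{{NonZero b}} →
                                   DefinitelyLeast a b u v → 2 * ∣ u ∣ ≤ b × 2 * ∣ v ∣ ≤ a
DefinitelyLeast⇒2*∣u∣≤b×2*∣v∣≤a {a} {b} {u} {v} (sol , least) =
  ∣i∣≤∣i∓n∣⇒2*∣i∣≤n u (proj₁ ≤-down) (proj₁ ≤-up) ,
  ∣i∣≤∣i∓n∣⇒2*∣i∣≤n v (proj₂ ≤-up) (proj₂ ≤-down)
  where
  shift-down : ∀ (A B X Y : ℤ) → A ℤ.* (X ℤ.- B) ℤ.+ B ℤ.* (Y ℤ.+ A) ≡ A ℤ.* X ℤ.+ B ℤ.* Y
  shift-down = ℤ-Solver.solve-∀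
  shift-up : ∀ (A B X Y : ℤ) → A ℤ.* (X ℤ.+ B) ℤ.+ B ℤ.* (Y ℤ.- A) ≡ A ℤ.* X ℤ.+ B ℤ.* Y
  shift-up = ℤ-Solver.solve-∀
  ≤-down : ∣ u ∣ ≤ ∣ u ℤ.- + b ∣ × ∣ v ∣ ≤ ∣ v ℤ.+ + a ∣
  ≤-down = least (u ℤ.- + b) (v ℤ.+ + a) (trans (shift-down (+ a) (+ b) u v) sol)
  ≤-up : ∣ u ∣ ≤ ∣ u ℤ.+ + b ∣ × ∣ v ∣ ≤ ∣ v ℤ.- + a ∣
  ≤-up = least (u ℤ.+ + b) (v ℤ.- + a) (trans (shift-up (+ a) (+ b) u v) sol)

a*x+b*y≢1 : ∀ {a b} x y → 2 ≤ a → 2 ≤ b → a * x + b * y ≢ 1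
a*x+b*y≢1 {a} {b} (suc x) y 2≤a _ eq = <⇒≱ 2≤a (begin
  a                   ≤⟨ m≤m*n a (suc x) ⟩
  a * suc x           ≤⟨ m≤m+n (a * suc x) (b * y) ⟩
  a * suc x + b * y   ≡⟨ eq ⟩
  1                   ∎)
  where open ≤-Reasoning
a*x+b*y≢1 {a} {b} zero (suc y) _ 2≤b eq = <⇒≱ 2≤b (begin
  b                   ≤⟨ m≤m*n b (suc y) ⟩
  b * suc y           ≤⟨ m≤n+m (b * suc y) (a * 0) ⟩
  a * 0 + b * suc y   ≡⟨ eq ⟩
  1                   ∎)
  where open ≤-Reasoning
a*x+b*y≢1 {a} {b} zero zero _ _ eq = 0≢1+n (trans (sym (cong₂ _+_ (*-zeroʳ a) (*-zeroʳ b))) eq)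

solves[x,-y]⇒bézout : ∀ {a b x y} → Solves a b (+ x) (ℤ.- + y) → 1 + y * b ≡ x * a
solves[x,-y]⇒bézout {a} {b} {x} {y} sol = ℤ.+-injective (begin
  + (1 + y * b)                                       ≡⟨ cong (ℤ._+_ (+ 1)) (ℤ.pos-* y b) ⟩
  + 1 ℤ.+ + y ℤ.* + b                                 ≡⟨ cong (ℤ._+ + y ℤ.* + b) sol ⟨
  + a ℤ.* + x ℤ.+ + b ℤ.* ℤ.- + y ℤ.+ + y ℤ.* + b     ≡⟨ cancel (+ a) (+ b) (+ x) (+ y) ⟩
  + x ℤ.* + a                                         ≡⟨ ℤ.pos-* x a ⟨
  + (x * a)                                           ∎)
  where
  open ≡-Reasoning
  cancel : ∀ (A B X Y : ℤ) → A ℤ.* X ℤ.+ B ℤ.* ℤ.- Y ℤ.+ Y ℤ.* B ≡ X ℤ.* A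
  cancel = ℤ-Solver.solve-∀

solves⇒bézout : ∀ {a b u v} → 2 ≤ a → 2 ≤ b → Solves a b u v →
                1 + ∣ v ∣ * b ≡ ∣ u ∣ * a ⊎ 1 + ∣ u ∣ * a ≡ ∣ v ∣ * b
solves⇒bézout {a} {b} {+ x} {+ y} 2≤a 2≤b sol =
  contradiction (ℤ.+-injective (trans (cong₂ ℤ._+_ (ℤ.pos-* a x) (ℤ.pos-* b y)) sol))
                (a*x+b*y≢1 x y 2≤a 2≤b)
solves⇒bézout {a} {b} {+ x} {v = -[1+ k ]} _ _ sol =
  inj₁ (solves[x,-y]⇒bézout {a} {b} {x} {suc k} sol)
solves⇒bézout {a} {b} {u = -[1+ j ]} {+ y} _ _ sol =
  inj₂ (solves[x,-y]⇒bézout {b} {a} {y} {suc j} (Solves-comm {a} {b} {u = -[1+ j ]} sol))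
solves⇒bézout {u = -[1+ _ ]} {v = -[1+ _ ]} (s≤s (s≤s _)) (s≤s (s≤s _)) ()

m+U*a+V*b≡F+a+b⇒m≡F-[U-1]a-[V-1]b : ∀ {m U V a b F} → m + U * a + V * b ≡ F + a + b →
  + m ≡ (+ F ℤ.- (+ U ℤ.- + 1) ℤ.* + a) ℤ.- (+ V ℤ.- + 1) ℤ.* + b
m+U*a+V*b≡F+a+b⇒m≡F-[U-1]a-[V-1]b {m} {U} {V} {a} {b} {F} eq = begin
  + m
    ≡⟨ isolate (+ m) (+ U ℤ.* + a) (+ V ℤ.* + b) ⟩
  + m ℤ.+ + U ℤ.* + a ℤ.+ + V ℤ.* + b ℤ.- + U ℤ.* + a ℤ.- + V ℤ.* + b
    ≡⟨ cong (λ i → i ℤ.- + U ℤ.* + a ℤ.- + V ℤ.* + b) lifted ⟩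
  + F ℤ.+ + a ℤ.+ + b ℤ.- + U ℤ.* + a ℤ.- + V ℤ.* + b
    ≡⟨ regroup (+ F) (+ U) (+ V) (+ a) (+ b) ⟩
  (+ F ℤ.- (+ U ℤ.- + 1) ℤ.* + a) ℤ.- (+ V ℤ.- + 1) ℤ.* + b
    ∎
  where
  open ≡-Reasoning
  lifted : + m ℤ.+ + U ℤ.* + a ℤ.+ + V ℤ.* + b ≡ + F ℤ.+ + a ℤ.+ + b
  lifted = trans (sym (cong₂ (λ i j → + m ℤ.+ i ℤ.+ j) (ℤ.pos-* U a) (ℤ.pos-* V b))) (cong +_ eq)
  isolate : ∀ (M X Y : ℤ) → M ≡ M ℤ.+ X ℤ.+ Y ℤ.- X ℤ.- Y
  isolate = ℤ-Solver.solve-∀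
  regroup : ∀ (F U V A B : ℤ) →
            F ℤ.+ A ℤ.+ B ℤ.- U ℤ.* A ℤ.- V ℤ.* B ≡ (F ℤ.- (U ℤ.- + 1) ℤ.* A) ℤ.- (V ℤ.- + 1) ℤ.* B
  regroup = ℤ-Solver.solve-∀

proposition4p9 : (a b : ℕ) → Coprime a b → 1 < a → a < b →
    (u v : ℤ) → DefinitelyLeast a b u v →
    (F : ℕ) → IsFrobenius a b F →
    Σ ℕ (λ m → IsMinIsolatedGap a b m ×
      (+ m ≡ (+ F ℤ.- (+ ∣ u ∣ ℤ.- + 1) ℤ.* + a) ℤ.- (+ ∣ v ∣ ℤ.- + 1) ℤ.* + b))
proposition4p9 a b a⊥b 2≤a a<b u v least F frob =
  let m , isMin , m+∣u∣a+∣v∣b≡F+a+b = oriented (solves⇒bézout 2≤a 2≤b (proj₁ least))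
  in  m , isMin , m+U*a+V*b≡F+a+b⇒m≡F-[U-1]a-[V-1]b {m} {∣ u ∣} {∣ v ∣} m+∣u∣a+∣v∣b≡F+a+b
  where
  2≤b : 2 ≤ b
  2≤b = <-trans 2≤a a<b
  2∣u∣≤b×2∣v∣≤a : 2 * ∣ u ∣ ≤ b × 2 * ∣ v ∣ ≤ a
  2∣u∣≤b×2∣v∣≤a = DefinitelyLeast⇒2*∣u∣≤b×2*∣v∣≤a
                    {{>-nonZero (<-trans z<s 2≤a)}} {{>-nonZero (<-trans z<s 2≤b)}} least
  oriented : 1 + ∣ v ∣ * b ≡ ∣ u ∣ * a ⊎ 1 + ∣ u ∣ * a ≡ ∣ v ∣ * b →
             Σ ℕ λ m → IsMinIsolatedGap a b m × m + ∣ u ∣ * a + ∣ v ∣ * b ≡ F + a + b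
  oriented (inj₁ bézout) =
    bézout⇒minIsolatedGap {U = ∣ u ∣} {∣ v ∣} a⊥b 2≤a 2≤b bézout (proj₁ 2∣u∣≤b×2∣v∣≤a) frob
  oriented (inj₂ bézout) =
    let m , isMin , m+∣v∣b+∣u∣a≡F+b+a =
          bézout⇒minIsolatedGap {U = ∣ v ∣} {∣ u ∣} (Coprime.sym a⊥b) 2≤b 2≤a bézout
                                (proj₂ 2∣u∣≤b×2∣v∣≤a) (IsFrobenius-comm frob)
    in  m , IsMinIsolatedGap-comm isMin ,
        trans (xy∙z≈xz∙y m (∣ u ∣ * a) (∣ v ∣ * b)) (trans m+∣v∣b+∣u∣a≡F+b+a (xy∙z≈xz∙y F b a))
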